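{- Let $H$ be a $d$-uniform hypergraph with $d\ge 2$, let $e\in E(H)$ and $v\in V(H)$. Then: (1) $\mathrm{Z}_0(H)-d\le \mathrm{Z}_0(H-e)\le \mathrm{Z}_0(H)+d$; (2) $\mathrm{Z}_0(H)-1\le \mathrm{Z}_0(H-v)$; (3) if $d=2$ (i.e., $H$ is a graph), then $\mathrm{Z}_0(H-v)\le \mathrm{Z}_0(H)+1$. Moreover, all of these bounds are tight: for each of these inequalities there exist $d\ge 2$, a $d$-hypergraph $H$ and an edge $e$ or vertex $v$ of $H$ for which it holds with equality.
   Context: $H-e$ is obtained from $H$ by deleting the edge $e$ from the edge set. $H-v$ is obtained by deleting the vertex $v$ and every edge containing $v$. $\mathrm{Z}_0(H)$: with a set $B$ initially blue and the other vertices white, a set $S$ of $d-1$ distinct vertices (not necessarily blue) can turn a white vertex $w$ blue if $S\cup\{w\}\in E(H)$ and every white $u$ with $S\cup\{u\}\in E(H)$ equals $w$. $B$ is a zero forcing set if repeated application colors all vertices blue; $\mathrm{Z}_0(H)$ is the minimum cardinality of a zero forcing set. -}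

module Defs where

open import Data.Nat using (ℕ; suc; _∸_; _≤_)
open import Data.Bool using (Bool; true; false; _∧_; not)
import Data.Bool as Bool
open import Data.Fin using (Fin)
open import Data.Fin.Subset using (Subset; ∣_∣; _∈_; _∉_; _∪_; ⁅_⁆; ⊤; outside)
open import Data.Vec using (insertAt)
open import Data.Vec.Properties using (≡-dec)
open import Data.Product using (Σ; _×_; ∃; _,_)
open import Relation.Nullary using (does)
open import Relation.Binary.PropositionalEquality using (_≡_)
open import Relation.Binary.Construct.Closure.ReflexiveTransitive using (Star)

Hypergraph : ℕ → Set
Hypergraph n = Subset n → Bool

_∈E_ : ∀ {n} → Subset n → Hypergraph n → Set
s ∈E H = H s ≡ true

Uniform : ∀ {n} → ℕ → Hypergraph n → Set
Uniform d H = ∀ s → s ∈E H → ∣ s ∣ ≡ d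

deleteEdge : ∀ {n} → Hypergraph n → Subset n → Hypergraph n
deleteEdge H e s = H s ∧ not (does (≡-dec Bool._≟_ s e))

-- The remaining
-- vertices Fin (suc n) ∖ {v} are identified with Fin n via punchIn v,
-- i.e. a subset s of Fin n corresponds to the subset of Fin (suc n)
-- obtained by inserting "outside" at position v.
deleteVertex : ∀ {n} → Hypergraph (suc n) → Fin (suc n) → Hypergraph n
deleteVertex H v s = H (insertAt s v outside)

-- One zero-forcing step (for a d-uniform hypergraph H) from blue set B
-- to blue set B': a set S of d-1 distinct vertices (not necessarily blue)
-- turns the white vertex w blue, where S ∪ {w} is an edge and w is the
-- only white vertex u with S ∪ {u} an edge.
ForceStep : ∀ {n} → ℕ → Hypergraph n → Subset n → Subset n → Set
ForceStep {n} d H B B' =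
  Σ (Subset n) λ S → Σ (Fin n) λ w →
    ∣ S ∣ ≡ d ∸ 1 ×
    w ∉ B ×
    (S ∪ ⁅ w ⁆) ∈E H ×
    (∀ u → u ∉ B → (S ∪ ⁅ u ⁆) ∈E H → u ≡ w) ×
    B' ≡ B ∪ ⁅ w ⁆

IsZeroForcingSet : ∀ {n} → ℕ → Hypergraph n → Subset n → Set
IsZeroForcingSet d H B = Star (ForceStep d H) B ⊤

IsZ0 : ∀ {n} → ℕ → Hypergraph n → ℕ → Set
IsZ0 {n} d H k =
  (Σ (Subset n) λ B → IsZeroForcingSet d H B × ∣ B ∣ ≡ k) ×
  (∀ B → IsZeroForcingSet d H B → k ≤ ∣ B ∣)

-- Every bound comes from translating a zero forcing process of one hypergraph into one of the
-- other. If H₂ agrees with H₁ on all edges that meet a vertex outside X, then colouring X blue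
-- in advance lets every force of H₁ be replayed in H₂, so Z₀(H₂) ≤ Z₀(H₁) + |X|; this gives
-- both edge bounds (X = e) and Z₀(H) ≤ Z₀(H - v) + 1 (X = {v}). For a graph, a forcing process
-- of H is replayed in H - v, where only the (at most one) force performed by v itself is lost;
-- adding the vertex v forces to the initial set repairs this, since afterwards every neighbour
-- of v is blue. The tightness examples are K₂, K₁ and the 4-cycle C₄, whose opposite vertices
-- are twins, of which every zero forcing set must contain one.
module Submission where

open import Defs
open import Data.Nat using (ℕ; suc; _+_; _≤_; _∸_; z≤n; s≤s)
import Data.Nat as ℕ
open import Data.Nat.Properties using (≤-trans; ≤-reflexive; +-suc; +-monoʳ-≤; module ≤-Reasoning)
open import Data.Bool using (true; false; _∨_)
import Data.Bool as Bool
open import Data.Bool.Properties using (∧-identityʳ; ∨-identityʳ)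
open import Data.Fin using (Fin; zero; suc; #_; punchIn; punchOut)
import Data.Fin as Fin
open import Data.Fin.Properties using (all?; punchIn-injective; punchIn-punchOut)
open import Data.Fin.Subset
  using (Subset; ∣_∣; _∈_; _∉_; _∪_; ⁅_⁆; ⊤; ⊥; inside; outside; _⊆_)
open import Data.Fin.Subset.Properties
  using ( _∈?_; ∈⊤; ⊆-antisym; p⊆p∪q; q⊆p∪q; x∈p∪q⁻; x∈⁅x⁆; x∈⁅y⁆⇒x≡y; p⊆q⇒∣p∣≤∣q∣
        ; ∣p∣≤∣x∷p∣; ∣⊥∣≡0; ∣⊤∣≡n; ∣⁅x⁆∣≡1)
open import Data.Vec using ([]; _∷_; insertAt; removeAt; lookup; here; there)
open import Data.Vec.Properties
  using (≡-dec; insertAt-lookup; insertAt-punchIn; insertAt-removeAt; []=⇒lookup; lookup⇒[]=)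
open import Data.Product using (Σ; ∃; _×_; _,_; proj₁)
open import Data.Sum using (_⊎_; inj₁; inj₂)
import Data.Sum as Sum
open import Data.Empty using (⊥-elim) renaming (⊥ to Empty)
open import Function using (id; _∘_; _⇔_; mk⇔; Equivalence)
import Function.Properties.Equivalence as ⇔
open import Relation.Nullary using (Dec; yes; no; ¬_; ¬?; _×-dec_; _→-dec_)
open import Relation.Nullary.Decidable using (True; toWitness; from-yes; map′)
open import Relation.Binary.PropositionalEquality
  using (_≡_; _≢_; refl; sym; trans; cong; subst; module ≡-Reasoning)
open import Relation.Binary.Construct.Closure.ReflexiveTransitive using (Star; ε; _◅_; _◅◅_)

private
  variable
    n m d k k' : ℕ

open Equivalence using (to; from)

∣p∪q∣≤∣p∣+∣q∣ : (p q : Subset n) → ∣ p ∪ q ∣ ≤ ∣ p ∣ + ∣ q ∣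
∣p∪q∣≤∣p∣+∣q∣ []            []            = z≤n
∣p∪q∣≤∣p∣+∣q∣ (inside  ∷ p) (x ∷ q)       =
  s≤s (≤-trans (∣p∪q∣≤∣p∣+∣q∣ p q) (+-monoʳ-≤ ∣ p ∣ (∣p∣≤∣x∷p∣ x q)))
∣p∪q∣≤∣p∣+∣q∣ (outside ∷ p) (inside  ∷ q) =
  ≤-trans (s≤s (∣p∪q∣≤∣p∣+∣q∣ p q)) (≤-reflexive (sym (+-suc ∣ p ∣ ∣ q ∣)))
∣p∪q∣≤∣p∣+∣q∣ (outside ∷ p) (outside ∷ q) = ∣p∪q∣≤∣p∣+∣q∣ p q

x∈p∪⁅y⁆⁻ : ∀ {x : Fin n} p y → x ∈ p ∪ ⁅ y ⁆ → x ∈ p ⊎ x ≡ y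
x∈p∪⁅y⁆⁻ p y x∈ = Sum.map₂ (x∈⁅y⁆⇒x≡y y) (x∈p∪q⁻ p ⁅ y ⁆ x∈)

y∈p∪⁅y⁆ : (p : Subset n) (y : Fin n) → y ∈ p ∪ ⁅ y ⁆
y∈p∪⁅y⁆ p y = q⊆p∪q p ⁅ y ⁆ (x∈⁅x⁆ y)

p∪⁅y⁆⊆q : ∀ {p q : Subset n} {y} → p ⊆ q → y ∈ q → p ∪ ⁅ y ⁆ ⊆ q
p∪⁅y⁆⊆q {p = p} {y = y} p⊆q y∈q x∈ with x∈p∪⁅y⁆⁻ p y x∈
... | inj₁ x∈p = p⊆q x∈p
... | inj₂ refl = y∈q

x∈p⇒1≤∣p∣ : ∀ {x : Fin n} {p} → x ∈ p → 1 ≤ ∣ p ∣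
x∈p⇒1≤∣p∣ {x = x} {p} x∈p =
  subst (_≤ ∣ p ∣) (∣⁅x⁆∣≡1 x) (p⊆q⇒∣p∣≤∣q∣ (λ y∈ → subst (_∈ p) (sym (x∈⁅y⁆⇒x≡y x y∈)) x∈p))

x≢y⇒2≤∣p∣ : ∀ {x y : Fin n} {p} → x ≢ y → x ∈ p → y ∈ p → 2 ≤ ∣ p ∣
x≢y⇒2≤∣p∣ {x = zero}  {zero}  x≢y _          _          = ⊥-elim (x≢y refl)
x≢y⇒2≤∣p∣ {x = zero}  {suc y} _   here       (there y∈) = s≤s (x∈p⇒1≤∣p∣ y∈)
x≢y⇒2≤∣p∣ {x = suc x} {zero}  _   (there x∈) here       = s≤s (x∈p⇒1≤∣p∣ x∈)
x≢y⇒2≤∣p∣ {x = suc x} {suc y} {b ∷ p} x≢y (there x∈) (there y∈) =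
  ≤-trans (x≢y⇒2≤∣p∣ (x≢y ∘ cong suc) x∈ y∈) (∣p∣≤∣x∷p∣ b p)

∣p∣≡1⇒p≡⁅x⁆ : ∀ {x : Fin n} {p} → ∣ p ∣ ≡ 1 → x ∈ p → p ≡ ⁅ x ⁆
∣p∣≡1⇒p≡⁅x⁆ {x = x} {p} ∣p∣≡1 x∈p = ⊆-antisym p⊆⁅x⁆ (λ y∈ → subst (_∈ p) (sym (x∈⁅y⁆⇒x≡y x y∈)) x∈p)
  where
  p⊆⁅x⁆ : p ⊆ ⁅ x ⁆
  p⊆⁅x⁆ {y} y∈p with y Fin.≟ x
  ... | yes refl = x∈⁅x⁆ x
  ... | no y≢x with subst (2 ≤_) ∣p∣≡1 (x≢y⇒2≤∣p∣ y≢x y∈p x∈p)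
  ...   | s≤s ()

allSubsets? : {P : Subset n → Set} → (∀ p → Dec (P p)) → Dec (∀ p → P p)
allSubsets? {n = ℕ.zero} P? = map′ (λ { P[] [] → P[] }) (λ ∀P → ∀P []) (P? [])
allSubsets? {n = suc n}  P? =
  map′ (λ { (P⁺ , P⁻) (inside ∷ p) → P⁺ p ; (P⁺ , P⁻) (outside ∷ p) → P⁻ p })
       (λ ∀P → (λ p → ∀P (inside ∷ p)) , (λ p → ∀P (outside ∷ p)))
       (allSubsets? (P? ∘ (inside ∷_)) ×-dec allSubsets? (P? ∘ (outside ∷_)))

≡⊎punchIn : (i y : Fin (suc n)) → y ≡ i ⊎ ∃ λ x → punchIn i x ≡ y
≡⊎punchIn i y with y Fin.≟ i
... | yes y≡i = inj₁ y≡i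
... | no  y≢i = inj₂ (punchOut (y≢i ∘ sym) , punchIn-punchOut (y≢i ∘ sym))

insertAt-∪ : ∀ (p q : Subset n) i a b → insertAt (p ∪ q) i (a ∨ b) ≡ insertAt p i a ∪ insertAt q i b
insertAt-∪ p       q       zero    a b = refl
insertAt-∪ (x ∷ p) (y ∷ q) (suc i) a b = cong ((x ∨ y) ∷_) (insertAt-∪ p q i a b)

insertAt-⊥ : (i : Fin (suc n)) → insertAt ⊥ i outside ≡ ⊥
insertAt-⊥         zero    = refl
insertAt-⊥ {suc n} (suc i) = cong (outside ∷_) (insertAt-⊥ i)

insertAt-⁅⁆ : ∀ (i : Fin (suc n)) x → insertAt ⁅ x ⁆ i outside ≡ ⁅ punchIn i x ⁆
insertAt-⁅⁆ zero    x       = refl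
insertAt-⁅⁆ (suc i) zero    = cong (inside ∷_) (insertAt-⊥ i)
insertAt-⁅⁆ (suc i) (suc x) = cong (outside ∷_) (insertAt-⁅⁆ i x)

insertAt-∪⁅⁆ : ∀ (p : Subset n) i a x → insertAt (p ∪ ⁅ x ⁆) i a ≡ insertAt p i a ∪ ⁅ punchIn i x ⁆
insertAt-∪⁅⁆ p i a x = begin
  insertAt (p ∪ ⁅ x ⁆) i a               ≡⟨ cong (insertAt (p ∪ ⁅ x ⁆) i) (sym (∨-identityʳ a)) ⟩
  insertAt (p ∪ ⁅ x ⁆) i (a ∨ false)     ≡⟨ insertAt-∪ p ⁅ x ⁆ i a false ⟩
  insertAt p i a ∪ insertAt ⁅ x ⁆ i false ≡⟨ cong (insertAt p i a ∪_) (insertAt-⁅⁆ i x) ⟩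
  insertAt p i a ∪ ⁅ punchIn i x ⁆       ∎
  where open ≡-Reasoning

∣insertAt-outside∣ : ∀ (p : Subset n) i → ∣ insertAt p i outside ∣ ≡ ∣ p ∣
∣insertAt-outside∣ p             zero    = refl
∣insertAt-outside∣ (inside  ∷ p) (suc i) = cong suc (∣insertAt-outside∣ p i)
∣insertAt-outside∣ (outside ∷ p) (suc i) = ∣insertAt-outside∣ p i

∈-insertAt⁺ : ∀ {x} (p : Subset n) i a → x ∈ p → punchIn i x ∈ insertAt p i a
∈-insertAt⁺ p i a x∈ = lookup⇒[]= _ _ (trans (insertAt-punchIn p i a _) ([]=⇒lookup x∈))

∈-insertAt⁻ : ∀ {x} (p : Subset n) i a → punchIn i x ∈ insertAt p i a → x ∈ p
∈-insertAt⁻ p i a x∈ = lookup⇒[]= _ _ (trans (sym (insertAt-punchIn p i a _)) ([]=⇒lookup x∈))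

i∈insertAt-inside : (p : Subset n) (i : Fin (suc n)) → i ∈ insertAt p i inside
i∈insertAt-inside p i = lookup⇒[]= _ _ (insertAt-lookup p i inside)

insertAt⊆insertAt-inside : ∀ (p : Subset n) i a → insertAt p i a ⊆ insertAt p i inside
insertAt⊆insertAt-inside p       zero    a here      = here
insertAt⊆insertAt-inside p       zero    a (there x) = there x
insertAt⊆insertAt-inside (_ ∷ p) (suc i) a here      = here
insertAt⊆insertAt-inside (_ ∷ p) (suc i) a (there x) = there (insertAt⊆insertAt-inside p i a x)

p⊆insertAt-removeAt : ∀ (p : Subset (suc n)) i → p ⊆ insertAt (removeAt p i) i inside
p⊆insertAt-removeAt p i x∈p =
  insertAt⊆insertAt-inside (removeAt p i) i _ (subst (_ ∈_) (sym (insertAt-removeAt p i)) x∈p)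

∣removeAt∣≤ : ∀ (p : Subset (suc n)) i → ∣ removeAt p i ∣ ≤ ∣ p ∣
∣removeAt∣≤ (a ∷ p)           zero    = ∣p∣≤∣x∷p∣ a p
∣removeAt∣≤ (inside  ∷ b ∷ p) (suc i) = s≤s (∣removeAt∣≤ (b ∷ p) i)
∣removeAt∣≤ (outside ∷ b ∷ p) (suc i) = ∣removeAt∣≤ (b ∷ p) i

i∉p⇒insertAt-removeAt : ∀ (p : Subset (suc n)) i → i ∉ p → ∃ λ q → p ≡ insertAt q i outside
i∉p⇒insertAt-removeAt p i i∉p with lookup p i in eq
... | inside  = ⊥-elim (i∉p (lookup⇒[]= i p eq))
... | outside = removeAt p i , trans (sym (insertAt-removeAt p i)) (cong (insertAt (removeAt p i) i) eq)

deleteEdge-≢ : ∀ (H : Hypergraph n) e s → s ≢ e → deleteEdge H e s ≡ H s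
deleteEdge-≢ H e s s≢e with ≡-dec Bool._≟_ s e
... | yes s≡e = ⊥-elim (s≢e s≡e)
... | no  _   = ∧-identityʳ (H s)

deleteVertex-∪⁅⁆ : ∀ (H : Hypergraph (suc n)) v S w →
  deleteVertex H v (S ∪ ⁅ w ⁆) ≡ H (insertAt S v outside ∪ ⁅ punchIn v w ⁆)
deleteVertex-∪⁅⁆ H v S w = cong H (insertAt-∪⁅⁆ S v outside w)

Forces : ℕ → Hypergraph n → Subset n → Subset n → Fin n → Set
Forces d H B S w =
  ∣ S ∣ ≡ d ∸ 1 × w ∉ B × (S ∪ ⁅ w ⁆) ∈E H × (∀ u → u ∉ B → (S ∪ ⁅ u ⁆) ∈E H → u ≡ w)

edge? : (H : Hypergraph n) (s : Subset n) → Dec (s ∈E H)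
edge? H s = H s Bool.≟ true

uniform? : ∀ d (H : Hypergraph n) → Dec (Uniform d H)
uniform? d H = allSubsets? λ s → edge? H s →-dec ∣ s ∣ ℕ.≟ d

edgeless? : (H : Hypergraph n) → Dec (∀ s → ¬ s ∈E H)
edgeless? H = allSubsets? λ s → ¬? (edge? H s)

forces? : ∀ d (H : Hypergraph n) B S w → Dec (Forces d H B S w)
forces? d H B S w =
  ∣ S ∣ ℕ.≟ d ∸ 1 ×-dec ¬? (w ∈? B) ×-dec edge? H (S ∪ ⁅ w ⁆) ×-dec
  all? (λ u → ¬? (u ∈? B) →-dec edge? H (S ∪ ⁅ u ⁆) →-dec u Fin.≟ w)

module Forcing (d : ℕ) (H : Hypergraph n) where

  force : ∀ {B} S w → {True (forces? d H B S w)} → ForceStep d H B (B ∪ ⁅ w ⁆)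
  force S w {ok} with toWitness ok
  ... | ∣S∣ , w∉B , edge , unique = S , w , ∣S∣ , w∉B , edge , unique , refl

module _ {H₁ : Hypergraph n} {H₂ : Hypergraph m} (_~_ : Subset n → Subset m → Set)
  (step : ∀ {B B' C} → B ~ C → ForceStep d H₁ B B' →
          ∃ λ C' → Star (ForceStep d H₂) C C' × B' ~ C')
  (done : ∀ {C} → ⊤ ~ C → C ≡ ⊤)
  where

  simulate : ∀ {B C} → B ~ C → IsZeroForcingSet d H₁ B → IsZeroForcingSet d H₂ C
  simulate B~C ε = subst (λ C → Star _ C ⊤) (sym (done B~C)) ε
  simulate B~C (σ ◅ τ) with step B~C σ
  ... | C' , σ' , B'~C' = σ' ◅◅ simulate B'~C' τ

IsZ0-≤ : ∀ d (H₁ : Hypergraph n) (H₂ : Hypergraph m) c →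
  (∀ B → IsZeroForcingSet d H₁ B → ∃ λ C → IsZeroForcingSet d H₂ C × ∣ C ∣ ≤ ∣ B ∣ + c) →
  IsZ0 d H₁ k → IsZ0 d H₂ k' → k' ≤ k + c
IsZ0-≤ _ _ _ _ translate ((B , zB , refl) , _) (_ , minimal) with translate B zB
... | C , zC , ∣C∣≤ = ≤-trans (minimal C zC) ∣C∣≤

IsZ0-0 : ∀ d (H : Hypergraph n) → IsZeroForcingSet d H ⊥ → IsZ0 d H 0
IsZ0-0 {n} _ _ z = (⊥ , z , ∣⊥∣≡0 n) , λ _ _ → z≤n

IsZ0-edgeless : ∀ d (H : Hypergraph n) → (∀ s → ¬ s ∈E H) → IsZ0 d H n
IsZ0-edgeless {n} d H edgeless = (⊤ , ε , ∣⊤∣≡n n) , minimal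
  where
  minimal : ∀ B → IsZeroForcingSet d H B → n ≤ ∣ B ∣
  minimal _ ε                               = ≤-reflexive (sym (∣⊤∣≡n n))
  minimal _ ((_ , _ , _ , _ , edge , _) ◅ _) = ⊥-elim (edgeless _ edge)

Twins : ℕ → Hypergraph n → Fin n → Fin n → Set
Twins d H a b = ∀ S → ∣ S ∣ ≡ d ∸ 1 → (S ∪ ⁅ a ⁆) ∈E H ⇔ (S ∪ ⁅ b ⁆) ∈E H

twins? : ∀ d (H : Hypergraph n) a b → Dec (Twins d H a b)
twins? d H a b = allSubsets? λ S → ∣ S ∣ ℕ.≟ d ∸ 1 →-dec ⇔-dec (edge? H (S ∪ ⁅ a ⁆)) (edge? H (S ∪ ⁅ b ⁆))
  where
  ⇔-dec : ∀ {A B : Set} → Dec A → Dec B → Dec (A ⇔ B)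
  ⇔-dec A? B? = map′ (λ (f , g) → mk⇔ f g) (λ A⇔B → to A⇔B , from A⇔B) ((A? →-dec B?) ×-dec (B? →-dec A?))

-- Forcing a twin while the other is white would violate uniqueness.
white-twin-stays-white : ∀ {H : Hypergraph n} {a b B B'} → a ≢ b → Twins d H a b →
  ForceStep d H B B' → a ∉ B → b ∉ B → a ∉ B'
white-twin-stays-white a≢b twins (S , w , ∣S∣ , _ , edge , unique , refl) a∉B b∉B a∈B'
  with x∈p∪⁅y⁆⁻ _ w a∈B'
... | inj₁ a∈B = a∉B a∈B
... | inj₂ refl = a≢b (sym (unique _ b∉B (to (twins S ∣S∣) edge)))

twin∈zeroForcingSet : ∀ d (H : Hypergraph n) a b {B} → a ≢ b → Twins d H a b →
  IsZeroForcingSet d H B → a ∈ B ⊎ b ∈ B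
twin∈zeroForcingSet d H a b {B} a≢b twins z with a ∈? B | b ∈? B
... | yes a∈B | _       = inj₁ a∈B
... | no  _   | yes b∈B = inj₂ b∈B
... | no  a∉B | no  b∉B = ⊥-elim (bothWhite z a∉B b∉B)
  where
  bothWhite : ∀ {B} → IsZeroForcingSet d H B → a ∉ B → b ∉ B → Empty
  bothWhite ε       a∉⊤ _   = a∉⊤ ∈⊤
  bothWhite (σ ◅ τ) a∉B b∉B = bothWhite τ
    (white-twin-stays-white {d = d} {H} a≢b twins σ a∉B b∉B)
    (white-twin-stays-white {d = d} {H} (a≢b ∘ sym) (λ S ∣S∣ → ⇔.sym (twins S ∣S∣)) σ b∉B a∉B)

-- Embeddings

-- H₂ looks like H₁, via vertex and lift, on every edge through a vertex outside X.
record Embedding (H₁ : Hypergraph n) (H₂ : Hypergraph m) (X : Subset m) : Set where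
  field
    vertex   : Fin n → Fin m
    lift     : Subset n → Subset m
    ∣lift∣   : ∀ s → ∣ lift s ∣ ≡ ∣ s ∣
    ∈-lift   : ∀ {x s} → x ∈ s → vertex x ∈ lift s
    lift-∪⁅⁆ : ∀ s x → lift (s ∪ ⁅ x ⁆) ≡ lift s ∪ ⁅ vertex x ⁆
    covers   : ∀ y → y ∉ X → ∃ λ x → vertex x ≡ y
    edge⇔    : ∀ s x → x ∈ s → vertex x ∉ X → s ∈E H₁ ⇔ lift s ∈E H₂

module _ {H₁ : Hypergraph n} {H₂ : Hypergraph m} {X} (E : Embedding H₁ H₂ X) where
  open Embedding E

  private
    _~_ : Subset n → Subset m → Set
    B ~ C = (∀ {x} → x ∈ B → vertex x ∈ C) × X ⊆ C

    replay : ∀ {d B B' C} → B ~ C → ForceStep d H₁ B B' → ∃ λ C' → Star (ForceStep d H₂) C C' × B' ~ C'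
    replay {d} {B} {C = C} (B↦C , X⊆C) (S , w , ∣S∣ , w∉B , edge , unique , refl)
      with vertex w ∈? C
    ... | yes w↦C = C , ε , B'↦ , X⊆C
      where
      B'↦ : ∀ {x} → x ∈ B ∪ ⁅ w ⁆ → vertex x ∈ C
      B'↦ x∈ with x∈p∪⁅y⁆⁻ B w x∈
      ... | inj₁ x∈B = B↦C x∈B
      ... | inj₂ refl = w↦C
    ... | no w↦̸C = C ∪ ⁅ vertex w ⁆ , (lift S , vertex w , ∣S∣′ , w↦̸C , edge′ , unique′ , refl) ◅ ε ,
                   B'↦ , p⊆p∪q ⁅ vertex w ⁆ ∘ X⊆C
      where
      ∣S∣′ : ∣ lift S ∣ ≡ d ∸ 1
      ∣S∣′ = trans (∣lift∣ S) ∣S∣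

      edge-through : ∀ x → vertex x ∉ C → (S ∪ ⁅ x ⁆) ∈E H₁ ⇔ (lift S ∪ ⁅ vertex x ⁆) ∈E H₂
      edge-through x x↦̸C = subst (λ s → (S ∪ ⁅ x ⁆) ∈E H₁ ⇔ s ∈E H₂) (lift-∪⁅⁆ S x)
        (edge⇔ (S ∪ ⁅ x ⁆) x (y∈p∪⁅y⁆ S x) (x↦̸C ∘ X⊆C))

      edge′ : (lift S ∪ ⁅ vertex w ⁆) ∈E H₂
      edge′ = to (edge-through w w↦̸C) edge

      unique′ : ∀ u → u ∉ C → (lift S ∪ ⁅ u ⁆) ∈E H₂ → u ≡ vertex w
      unique′ u u∉C edge-u with covers u (u∉C ∘ X⊆C)
      ... | x , refl = cong vertex (unique x (u∉C ∘ B↦C) (from (edge-through x u∉C) edge-u))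

      B'↦ : ∀ {x} → x ∈ B ∪ ⁅ w ⁆ → vertex x ∈ C ∪ ⁅ vertex w ⁆
      B'↦ x∈ with x∈p∪⁅y⁆⁻ B w x∈
      ... | inj₁ x∈B = p⊆p∪q ⁅ vertex w ⁆ (B↦C x∈B)
      ... | inj₂ refl = y∈p∪⁅y⁆ C (vertex w)

    covered : ∀ {C} → ⊤ ~ C → C ≡ ⊤
    covered {C} (⊤↦C , X⊆C) = ⊆-antisym (λ _ → ∈⊤) C-full
      where
      C-full : ⊤ ⊆ C
      C-full {y} _ with y ∈? C
      ... | yes y∈C = y∈C
      ... | no  y∉C with covers y (y∉C ∘ X⊆C)
      ...   | x , refl = ⊤↦C ∈⊤

  Embedding⇒zeroForcingSet : ∀ {B} → IsZeroForcingSet d H₁ B → IsZeroForcingSet d H₂ (lift B ∪ X)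
  Embedding⇒zeroForcingSet {d} {B} =
    simulate {d = d} {H₁ = H₁} {H₂ = H₂} _~_ (replay {d}) covered (p⊆p∪q X ∘ ∈-lift , q⊆p∪q (lift B) X)

  Embedding⇒Z0≤ : ∀ d → IsZ0 d H₁ k → IsZ0 d H₂ k' → k' ≤ k + ∣ X ∣
  Embedding⇒Z0≤ d = IsZ0-≤ d H₁ H₂ ∣ X ∣ λ B z →
    lift B ∪ X , Embedding⇒zeroForcingSet {d} z ,
    ≤-trans (∣p∪q∣≤∣p∣+∣q∣ (lift B) X) (≤-reflexive (cong (_+ ∣ X ∣) (∣lift∣ B)))

agreeOutside⇒Embedding : ∀ {H₁ H₂ : Hypergraph n} {X} →
  (∀ s x → x ∈ s → x ∉ X → s ∈E H₁ ⇔ s ∈E H₂) → Embedding H₁ H₂ X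
agreeOutside⇒Embedding agree = record
  { vertex = id ; lift = id ; ∣lift∣ = λ _ → refl ; ∈-lift = id ; lift-∪⁅⁆ = λ _ _ → refl
  ; covers = λ y _ → y , refl ; edge⇔ = agree }

deleteEdge-agreeOutside : ∀ (H : Hypergraph n) e s x → x ∈ s → x ∉ e → s ∈E deleteEdge H e ⇔ s ∈E H
deleteEdge-agreeOutside H e s x x∈s x∉e = mk⇔ (trans (sym H-e≡H)) (trans H-e≡H)
  where
  H-e≡H : deleteEdge H e s ≡ H s
  H-e≡H = deleteEdge-≢ H e s (λ s≡e → x∉e (subst (x ∈_) s≡e x∈s))

deleteVertex-embeds : ∀ (H : Hypergraph (suc n)) v → Embedding (deleteVertex H v) H ⁅ v ⁆
deleteVertex-embeds H v = record
  { vertex = punchIn v ; lift = λ s → insertAt s v outside ; ∣lift∣ = λ s → ∣insertAt-outside∣ s v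
  ; ∈-lift = ∈-insertAt⁺ _ v outside ; lift-∪⁅⁆ = λ s x → insertAt-∪⁅⁆ s v outside x
  ; covers = covers ; edge⇔ = λ _ _ _ _ → ⇔.refl }
  where
  covers : ∀ y → y ∉ ⁅ v ⁆ → ∃ λ x → punchIn v x ≡ y
  covers y y∉⁅v⁆ with ≡⊎punchIn v y
  ... | inj₁ refl = ⊥-elim (y∉⁅v⁆ (x∈⁅x⁆ v))
  ... | inj₂ x↦y  = x↦y

Z0≤Z0-deleteEdge+∣e∣ : ∀ d (H : Hypergraph n) e → IsZ0 d H k → IsZ0 d (deleteEdge H e) k' → k ≤ k' + ∣ e ∣
Z0≤Z0-deleteEdge+∣e∣ d H e Z Z' =
  Embedding⇒Z0≤ (agreeOutside⇒Embedding (deleteEdge-agreeOutside H e)) d Z' Z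

Z0-deleteEdge≤Z0+∣e∣ : ∀ d (H : Hypergraph n) e → IsZ0 d H k → IsZ0 d (deleteEdge H e) k' → k' ≤ k + ∣ e ∣
Z0-deleteEdge≤Z0+∣e∣ d H e =
  Embedding⇒Z0≤ (agreeOutside⇒Embedding λ s x x∈s x∉e → ⇔.sym (deleteEdge-agreeOutside H e s x x∈s x∉e)) d

Z0≤Z0-deleteVertex+1 : ∀ d (H : Hypergraph (suc n)) v → IsZ0 d H k → IsZ0 d (deleteVertex H v) k' → k ≤ k' + 1
Z0≤Z0-deleteVertex+1 d H v Z Z' =
  subst (λ c → _ ≤ _ + c) (∣⁅x⁆∣≡1 v) (Embedding⇒Z0≤ (deleteVertex-embeds H v) d Z' Z)

-- Deleting a vertex of a graph

module _ (H : Hypergraph (suc n)) (v : Fin (suc n)) where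

  private
    _⁺ : Subset n → Subset (suc n)
    C ⁺ = insertAt C v inside

    H-v = deleteVertex H v

  force-avoiding : ∀ {d B B' C} → B ⊆ C ⁺ → (σ : ForceStep d H B B') → v ∉ proj₁ σ →
    ∃ λ C' → Star (ForceStep d H-v) C C' × B' ⊆ C' ⁺ × C ⁺ ⊆ C' ⁺
  force-avoiding {d} {B} {C = C} B⊆C⁺ (S , w , ∣S∣ , w∉B , edge , unique , refl) v∉S
    with w ∈? C ⁺
  ... | yes w∈C⁺ = C , ε , p∪⁅y⁆⊆q B⊆C⁺ w∈C⁺ , id
  ... | no  w∉C⁺ with ≡⊎punchIn v w | i∉p⇒insertAt-removeAt S v v∉S
  ...   | inj₁ refl       | _          = ⊥-elim (w∉C⁺ (i∈insertAt-inside C v))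
  ...   | inj₂ (x , refl) | (S' , refl) =
    C ∪ ⁅ x ⁆ , (S' , x , ∣S'∣ , w∉C⁺ ∘ ∈-insertAt⁺ C v inside , edge′ , unique′ , refl) ◅ ε ,
    subst (B ∪ ⁅ w ⁆ ⊆_) (sym C'⁺) (p∪⁅y⁆⊆q (p⊆p∪q ⁅ w ⁆ ∘ B⊆C⁺) (y∈p∪⁅y⁆ (C ⁺) w)) ,
    subst (C ⁺ ⊆_) (sym C'⁺) (p⊆p∪q ⁅ w ⁆)
    where
    C'⁺ : (C ∪ ⁅ x ⁆) ⁺ ≡ C ⁺ ∪ ⁅ w ⁆
    C'⁺ = insertAt-∪⁅⁆ C v inside x

    ∣S'∣ : ∣ S' ∣ ≡ d ∸ 1
    ∣S'∣ = trans (sym (∣insertAt-outside∣ S' v)) ∣S∣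

    edge′ : (S' ∪ ⁅ x ⁆) ∈E H-v
    edge′ = trans (deleteVertex-∪⁅⁆ H v S' x) edge

    unique′ : ∀ u → u ∉ C → (S' ∪ ⁅ u ⁆) ∈E H-v → u ≡ x
    unique′ u u∉C edge-u = punchIn-injective v u x
      (unique (punchIn v u) (u∉C ∘ ∈-insertAt⁻ C v inside ∘ B⊆C⁺)
              (trans (sym (deleteVertex-∪⁅⁆ H v S' u)) edge-u))

  private
    NeighboursBlue : Subset (suc n) → Set
    NeighboursBlue B = ∀ u → (⁅ v ⁆ ∪ ⁅ u ⁆) ∈E H → u ∈ B

    ⊤⊆C⁺⇒C≡⊤ : ∀ {C} → ⊤ ⊆ C ⁺ → C ≡ ⊤
    ⊤⊆C⁺⇒C≡⊤ {C} ⊤⊆C⁺ = ⊆-antisym (λ _ → ∈⊤) (λ _ → ∈-insertAt⁻ C v inside (⊤⊆C⁺ ∈⊤))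

    -- Once the neighbours of v are blue, v can never force again.
    afterForceOfV : ∀ {B C} → IsZeroForcingSet 2 H B → B ⊆ C ⁺ → NeighboursBlue B → IsZeroForcingSet 2 H-v C
    afterForceOfV z B⊆C⁺ blue = simulate {d = 2} {H₁ = H} {H₂ = H-v} _~_ replay (⊤⊆C⁺⇒C≡⊤ ∘ proj₁) (B⊆C⁺ , blue) z
      where
      _~_ : Subset (suc n) → Subset n → Set
      B ~ C = B ⊆ C ⁺ × NeighboursBlue B

      replay : ∀ {B B' C} → B ~ C → ForceStep 2 H B B' → ∃ λ C' → Star (ForceStep 2 H-v) C C' × B' ~ C'
      replay (B⊆C⁺ , blue) σ@(S , w , ∣S∣ , w∉B , edge , _ , refl) with v ∈? S
      ... | yes v∈S = ⊥-elim (w∉B (blue w (subst (λ T → (T ∪ ⁅ w ⁆) ∈E H) (∣p∣≡1⇒p≡⁅x⁆ ∣S∣ v∈S) edge)))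
      ... | no  v∉S with force-avoiding {d = 2} B⊆C⁺ σ v∉S
      ...   | C' , σ' , B'⊆C'⁺ , _ = C' , σ' , B'⊆C'⁺ , λ u edge-u → p⊆p∪q ⁅ w ⁆ (blue u edge-u)

    -- W is the vertex forced by v (if v forces at all); it must be supplied in advance.
    beforeForceOfV : ∀ {B} → IsZeroForcingSet 2 H B →
      Σ (Subset (suc n)) λ W → ∣ W ∣ ≤ 1 × (∀ {C} → B ⊆ C ⁺ → W ⊆ C ⁺ → IsZeroForcingSet 2 H-v C)
    beforeForceOfV ε = ⊥ , ≤-trans (≤-reflexive (∣⊥∣≡0 (suc n))) z≤n , λ ⊤⊆C⁺ _ →
      subst (λ C → Star _ C ⊤) (sym (⊤⊆C⁺⇒C≡⊤ ⊤⊆C⁺)) ε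
    beforeForceOfV {B = B} (σ@(S , w , ∣S∣ , _ , _ , unique , refl) ◅ τ) with v ∈? S
    ... | yes v∈S = ⁅ w ⁆ , ≤-reflexive (∣⁅x⁆∣≡1 w) ,
                    λ B⊆C⁺ W⊆C⁺ → afterForceOfV τ (p∪⁅y⁆⊆q B⊆C⁺ (W⊆C⁺ (x∈⁅x⁆ w))) blue
      where
      blue : NeighboursBlue (B ∪ ⁅ w ⁆)
      blue u edge-u with u ∈? B
      ... | yes u∈B = p⊆p∪q ⁅ w ⁆ u∈B
      ... | no  u∉B = subst (_∈ B ∪ ⁅ w ⁆)
            (sym (unique u u∉B (subst (λ T → (T ∪ ⁅ u ⁆) ∈E H) (sym (∣p∣≡1⇒p≡⁅x⁆ ∣S∣ v∈S)) edge-u)))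
            (y∈p∪⁅y⁆ B w)
    ... | no v∉S with beforeForceOfV τ
    ...   | W , ∣W∣≤1 , continue = W , ∣W∣≤1 , λ B⊆C⁺ W⊆C⁺ →
      let C' , σ' , B'⊆C'⁺ , C⁺⊆C'⁺ = force-avoiding {d = 2} B⊆C⁺ σ v∉S
      in σ' ◅◅ continue B'⊆C'⁺ (C⁺⊆C'⁺ ∘ W⊆C⁺)

  deleteVertex-zeroForcingSet : ∀ B → IsZeroForcingSet 2 H B →
    ∃ λ C → IsZeroForcingSet 2 H-v C × ∣ C ∣ ≤ ∣ B ∣ + 1
  deleteVertex-zeroForcingSet B z with beforeForceOfV z
  ... | W , ∣W∣≤1 , continue =
    removeAt (B ∪ W) v ,
    continue (p⊆insertAt-removeAt (B ∪ W) v ∘ p⊆p∪q W) (p⊆insertAt-removeAt (B ∪ W) v ∘ q⊆p∪q B W) ,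
    (begin
      ∣ removeAt (B ∪ W) v ∣ ≤⟨ ∣removeAt∣≤ (B ∪ W) v ⟩
      ∣ B ∪ W ∣             ≤⟨ ∣p∪q∣≤∣p∣+∣q∣ B W ⟩
      ∣ B ∣ + ∣ W ∣          ≤⟨ +-monoʳ-≤ ∣ B ∣ ∣W∣≤1 ⟩
      ∣ B ∣ + 1              ∎)
    where open ≤-Reasoning

Z0-deleteVertex≤Z0+1 : ∀ (H : Hypergraph (suc n)) v → IsZ0 2 H k → IsZ0 2 (deleteVertex H v) k' → k' ≤ k + 1
Z0-deleteVertex≤Z0+1 H v = IsZ0-≤ 2 H (deleteVertex H v) 1 (deleteVertex-zeroForcingSet H v)

K₁ : Hypergraph 1
K₁ _ = false

K₂ : Hypergraph 2
K₂ (inside ∷ inside ∷ []) = true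
K₂ _                      = false

C₄ : Hypergraph 4
C₄ (inside  ∷ inside  ∷ outside ∷ outside ∷ []) = true
C₄ (outside ∷ inside  ∷ inside  ∷ outside ∷ []) = true
C₄ (outside ∷ outside ∷ inside  ∷ inside  ∷ []) = true
C₄ (inside  ∷ outside ∷ outside ∷ inside  ∷ []) = true
C₄ _                                            = false

e₀₁ : Subset 4
e₀₁ = ⁅ # 0 ⁆ ∪ ⁅ # 1 ⁆

C₄-Z0 : IsZ0 2 C₄ 2
C₄-Z0 = (e₀₁ , force ⁅ # 0 ⁆ (# 3) ◅ force ⁅ # 1 ⁆ (# 2) ◅ ε , refl) , minimal
  where
  open Forcing 2 C₄

  minimal : ∀ B → IsZeroForcingSet 2 C₄ B → 2 ≤ ∣ B ∣
  minimal B z with twin∈zeroForcingSet 2 C₄ (# 0) (# 2) (λ ()) (from-yes (twins? 2 C₄ (# 0) (# 2))) z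
                 | twin∈zeroForcingSet 2 C₄ (# 1) (# 3) (λ ()) (from-yes (twins? 2 C₄ (# 1) (# 3))) z
  ... | inj₁ x∈B | inj₁ y∈B = x≢y⇒2≤∣p∣ (λ ()) x∈B y∈B
  ... | inj₁ x∈B | inj₂ y∈B = x≢y⇒2≤∣p∣ (λ ()) x∈B y∈B
  ... | inj₂ x∈B | inj₁ y∈B = x≢y⇒2≤∣p∣ (λ ()) x∈B y∈B
  ... | inj₂ x∈B | inj₂ y∈B = x≢y⇒2≤∣p∣ (λ ()) x∈B y∈B

C₄-e₀₁-Z0 : IsZ0 2 (deleteEdge C₄ e₀₁) 0
C₄-e₀₁-Z0 = IsZ0-0 2 (deleteEdge C₄ e₀₁)
  (force ⁅ # 1 ⁆ (# 2) ◅ force ⁅ # 0 ⁆ (# 3) ◅ force ⁅ # 3 ⁆ (# 0) ◅ force ⁅ # 2 ⁆ (# 1) ◅ ε)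
  where open Forcing 2 (deleteEdge C₄ e₀₁)

K₂-Z0 : IsZ0 2 K₂ 0
K₂-Z0 = IsZ0-0 2 K₂ (force ⁅ # 0 ⁆ (# 1) ◅ force ⁅ # 1 ⁆ (# 0) ◅ ε)
  where open Forcing 2 K₂

proposition3p18 :
    ((n d : ℕ) → 2 ≤ d → (H : Hypergraph n) → Uniform d H →
      (e : Subset n) → e ∈E H → (k k' : ℕ) →
      IsZ0 d H k → IsZ0 d (deleteEdge H e) k' →
      (k ≤ k' + d) × (k' ≤ k + d))
    × ((n d : ℕ) → 2 ≤ d → (H : Hypergraph (suc n)) → Uniform d H →
      (v : Fin (suc n)) → (k k' : ℕ) →
      IsZ0 d H k → IsZ0 d (deleteVertex H v) k' →
      k ≤ k' + 1)
    × ((n : ℕ) → (H : Hypergraph (suc n)) → Uniform 2 H →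
      (v : Fin (suc n)) → (k k' : ℕ) →
      IsZ0 2 H k → IsZ0 2 (deleteVertex H v) k' →
      k' ≤ k + 1)
    × (Σ ℕ λ n → Σ ℕ λ d → 2 ≤ d × Σ (Hypergraph n) λ H → Uniform d H ×
        Σ (Subset n) λ e → e ∈E H × Σ ℕ λ k → Σ ℕ λ k' →
        IsZ0 d H k × IsZ0 d (deleteEdge H e) k' × k ≡ k' + d)
    × (Σ ℕ λ n → Σ ℕ λ d → 2 ≤ d × Σ (Hypergraph n) λ H → Uniform d H ×
        Σ (Subset n) λ e → e ∈E H × Σ ℕ λ k → Σ ℕ λ k' →
        IsZ0 d H k × IsZ0 d (deleteEdge H e) k' × k' ≡ k + d)
    × (Σ ℕ λ n → Σ ℕ λ d → 2 ≤ d × Σ (Hypergraph (suc n)) λ H → Uniform d H ×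
        Σ (Fin (suc n)) λ v → Σ ℕ λ k → Σ ℕ λ k' →
        IsZ0 d H k × IsZ0 d (deleteVertex H v) k' × k ≡ k' + 1)
    × (Σ ℕ λ n → Σ (Hypergraph (suc n)) λ H → Uniform 2 H ×
        Σ (Fin (suc n)) λ v → Σ ℕ λ k → Σ ℕ λ k' →
        IsZ0 2 H k × IsZ0 2 (deleteVertex H v) k' × k' ≡ k + 1)
proposition3p18 =
  (λ _ d _ H uniform e e∈H _ _ Z Z' →
    let ∣e∣≡d = uniform e e∈H in
    subst (λ c → _ ≤ _ + c) ∣e∣≡d (Z0≤Z0-deleteEdge+∣e∣ d H e Z Z') ,
    subst (λ c → _ ≤ _ + c) ∣e∣≡d (Z0-deleteEdge≤Z0+∣e∣ d H e Z Z')) ,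
  (λ _ d _ H _ v _ _ → Z0≤Z0-deleteVertex+1 d H v) ,
  (λ _ H _ v _ _ → Z0-deleteVertex≤Z0+1 H v) ,
  (4 , 2 , s≤s (s≤s z≤n) , C₄ , from-yes (uniform? 2 C₄) , e₀₁ , refl , 2 , 0 ,
    C₄-Z0 , C₄-e₀₁-Z0 , refl) ,
  (2 , 2 , s≤s (s≤s z≤n) , K₂ , from-yes (uniform? 2 K₂) , ⊤ , refl , 0 , 2 ,
    K₂-Z0 , IsZ0-edgeless 2 (deleteEdge K₂ ⊤) (from-yes (edgeless? (deleteEdge K₂ ⊤))) , refl) ,
  (0 , 2 , s≤s (s≤s z≤n) , K₁ , (λ _ ()) , zero , 1 , 0 ,
    IsZ0-edgeless 2 K₁ (λ _ ()) , IsZ0-edgeless 2 (deleteVertex K₁ zero) (λ _ ()) , refl) ,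
  (1 , K₂ , from-yes (uniform? 2 K₂) , zero , 0 , 1 ,
    K₂-Z0 , IsZ0-edgeless 2 (deleteVertex K₂ zero) (from-yes (edgeless? (deleteVertex K₂ zero))) , refl)
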